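{- Let $\mu$ be a lattice path whose first step is $U$ and last step is $D$, and let $M=1+\max_j y(j)$, where the labels $y(j)$ are those of $\mu$. Then \[ F_{\mu}(x,y,p,q)=F_{\overline{\mu}}\bigl(p^{M}q^{M}x,\;y,\;q^{ -1},\;p^{ -1}\bigr). \]
   Context: Lattice paths use up steps $U=(0,1)$ and right steps $D=(1,0)$. The dual of $\mu=\mu_1\cdots\mu_m$ is $\overline{\mu}=\overline{\mu_m}\cdots\overline{\mu_1}$, where $\overline{U}=D$ and $\overline{D}=U$. **Labels of $\mu$.** Let $N(U)$ and $N(D)$ be the numbers of up and right steps of $\mu$. For $0\le i\le N(D)-1$, let $h(i)$ be the height of the right step of $\mu$ from $(i,h(i))$ to $(i+1,h(i))$, and put $s'_i=N(U)+1-h(i)$. The sequence $s_i$ is obtained by the following algorithm: 1. Set $i=N(D)-2$. 2. If $s'_i=s'_{i+1}$, increase all current $s'_j$ with $j\le i$ by one. 3. If $i\ne 0$, decrease $i$ by one and repeat step 2; stop after treating $i=0$. Then $s_i$ is the label of $(i,0)$. The labels $y(j)$ of the points $(N(D),j)$, $1\le j\le N(U)$, are defined as follows. If $\mu$ has a peak $UD$ whose $U$ ends at $(i,j)$, then $y(j)=s_i+1$. Otherwise $y(j)=1+y(j+1)$. **Generating function.** A path $\nu$ with the same endpoints as $\mu$ is weakly below $\mu$ if, for every $t$, $\nu$ has at least as many $D$'s as $\mu$ among its first $t$ steps. Each such $\nu$ corresponds in the paper to a heap of type I whose staircases are the segments $[s_i,y(j)]$, one for each peak of $\nu$ at $(i,j)$,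 using the labels of $\mu$. The valuation is $x^{\#\text{staircases}}y^{\sum\text{lengths of pieces}}p^{\sum\text{left abscissae}}q^{\sum\text{right abscissae}}$. Explicitly, \[ F_\mu(x,y,p,q)=\sum_{\nu}\prod_{\text{peaks }(i,j)\text{ of }\nu} x\,y^{\,y(j)-s_i}\,p^{\,s_i}\,q^{\,y(j)}, \] summed over all paths $\nu$ weakly below $\mu$. $F_{\overline{\mu}}$ is defined in the same way from $\overline{\mu}$ and its own labels. -}

module Defs where

open import Data.Nat as ℕ using (ℕ; zero; suc; _+_; _*_; _∸_; _⊔_; _≡ᵇ_; _≤ᵇ_)
open import Data.Integer as ℤ using (ℤ; +_)
open import Data.Bool using (Bool; true; false; if_then_else_)
open import Data.List using (List; []; _∷_; _++_; map; length; foldr; filter; take; upTo)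
open import Data.Maybe using (Maybe; just; nothing)
open import Data.Product using (_×_; _,_; proj₁; proj₂)
open import Data.Product.Properties using (≡-dec)
open import Relation.Binary.PropositionalEquality using (_≡_)
open import Relation.Nullary using (Dec)
open import Data.Bool using (_∧_)

-- Lattice paths: U = (0,1) up step, D = (1,0) right step.

data Step : Set where
  U D : Step

Path : Set
Path = List Step

dualStep : Step → Step
dualStep U = D
dualStep D = U

dual : Path → Path
dual [] = []
dual (s ∷ ss) = dual ss ++ (dualStep s ∷ [])

isU isD : Step → Bool
isU U = true
isU D = false
isD U = false
isD D = true

countU countD : Path → ℕ
countU [] = 0
countU (U ∷ ss) = suc (countU ss)
countU (D ∷ ss) = countU ss
countD [] = 0
countD (U ∷ ss) = countD ss
countD (D ∷ ss) = suc (countD ss)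

at : List ℕ → ℕ → ℕ
at [] _ = 0
at (x ∷ xs) zero = x
at (x ∷ xs) (suc i) = at xs i

dHeightsFrom : ℕ → Path → List ℕ
dHeightsFrom h [] = []
dHeightsFrom h (U ∷ ss) = dHeightsFrom (suc h) ss
dHeightsFrom h (D ∷ ss) = h ∷ dHeightsFrom h ss

height : Path → ℕ → ℕ
height μ i = at (dHeightsFrom 0 μ) i

s′ : Path → ℕ → ℕ
s′ μ i = suc (countU μ) ∸ height μ i

algStep : ℕ → (ℕ → ℕ) → (ℕ → ℕ)
algStep i s = if s i ≡ᵇ s (suc i)
              then (λ j → if j ≤ᵇ i then suc (s j) else s j)
              else s

algDown : ℕ → (ℕ → ℕ) → (ℕ → ℕ)
algDown zero s = algStep zero s
algDown (suc i) s = algDown i (algStep (suc i) s)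

-- run the algorithm starting at i = N(D) - 2 (nothing to do if N(D) < 2)
algRun : ℕ → (ℕ → ℕ) → (ℕ → ℕ)
algRun zero s = s
algRun (suc zero) s = s
algRun (suc (suc n)) s = algDown n s

-- the label s_i of the point (i,0)
sLabel : Path → ℕ → ℕ
sLabel μ = algRun (countD μ) (s′ μ)

-- Peaks: a peak UD whose U ends at (i,j) is recorded as (i , j)

peaksFrom : ℕ → ℕ → Path → List (ℕ × ℕ)
peaksFrom i j [] = []
peaksFrom i j (U ∷ D ∷ ss) = (i , suc j) ∷ peaksFrom (suc i) (suc j) ss
peaksFrom i j (U ∷ ss) = peaksFrom i (suc j) ss
peaksFrom i j (D ∷ ss) = peaksFrom (suc i) j ss

peaks : Path → List (ℕ × ℕ)
peaks = peaksFrom 0 0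

peakAtHeight : List (ℕ × ℕ) → ℕ → Maybe ℕ
peakAtHeight [] j = nothing
peakAtHeight ((i , j′) ∷ ps) j = if j′ ≡ᵇ j then just i else peakAtHeight ps j

-- yGo μ k = y(N(U) - k)  (top-down recursion y(j) = 1 + y(j+1)).
-- At k = 0 (j = N(U)) there is always a peak when the last step is D;
-- the 'nothing' value there (1) is an unreachable default.
yGo : Path → ℕ → ℕ
yGo μ zero with peakAtHeight (peaks μ) (countU μ)
... | just i = suc (sLabel μ i)
... | nothing = 1
yGo μ (suc k) with peakAtHeight (peaks μ) (countU μ ∸ suc k)
... | just i = suc (sLabel μ i)
... | nothing = suc (yGo μ k)

-- the label y(j) of the point (N(D), j), for 1 ≤ j ≤ N(U)
yLabel : Path → ℕ → ℕ
yLabel μ j = yGo μ (countU μ ∸ j)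

bigM : Path → ℕ
bigM μ = suc (foldr _⊔_ 0 (map (λ k → yLabel μ (suc k)) (upTo (countU μ))))

allPaths : ℕ → ℕ → List Path
allPaths zero zero = [] ∷ []
allPaths (suc a) zero = map (U ∷_) (allPaths a zero)
allPaths zero (suc b) = map (D ∷_) (allPaths zero b)
allPaths (suc a) (suc b) = map (U ∷_) (allPaths a (suc b)) ++ map (D ∷_) (allPaths (suc a) b)

allᵇ : (ℕ → Bool) → List ℕ → Bool
allᵇ f [] = true
allᵇ f (x ∷ xs) = f x ∧ allᵇ f xs

weaklyBelow : Path → Path → Bool
weaklyBelow ν μ = allᵇ (λ t → countD (take t μ) ≤ᵇ countD (take t ν)) (upTo (suc (length μ)))

pathsBelow : Path → List Path
pathsBelow μ = filter (λ ν → weaklyBelow ν μ ≟b true) (allPaths (countU μ) (countD μ))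
  where
  open import Data.Bool.Properties using () renaming (_≟_ to _≟b_)

-- Laurent polynomials in x, y, p, q with natural coefficients, given
-- as formal sums of monomials.  A monomial x^a y^b p^c q^d is the
-- exponent vector (a , b , c , d) ∈ ℤ⁴.

Monomial : Set
Monomial = ℤ × ℤ × ℤ × ℤ

LaurentPoly : Set
LaurentPoly = List Monomial

_≟ₘ_ : (m n : Monomial) → Dec (m ≡ n)
_≟ₘ_ = ≡-dec ℤ._≟_ (≡-dec ℤ._≟_ (≡-dec ℤ._≟_ ℤ._≟_))

coeff : LaurentPoly → Monomial → ℕ
coeff P m = length (filter (λ n → n ≟ₘ m) P)

_≈ₚ_ : LaurentPoly → LaurentPoly → Set
P ≈ₚ Q = ∀ m → coeff P m ≡ coeff Q m

_·ₘ_ : Monomial → Monomial → Monomial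
(a , b , c , d) ·ₘ (a′ , b′ , c′ , d′) = (a ℤ.+ a′ , b ℤ.+ b′ , c ℤ.+ c′ , d ℤ.+ d′)

oneₘ : Monomial
oneₘ = (+ 0 , + 0 , + 0 , + 0)

peakWeight : Path → ℕ × ℕ → Monomial
peakWeight μ (i , j) = (+ 1 , (+ yLabel μ j) ℤ.- (+ sLabel μ i) , + sLabel μ i , + yLabel μ j)

pathWeight : Path → Path → Monomial
pathWeight μ ν = foldr _·ₘ_ oneₘ (map (peakWeight μ) (peaks ν))

F : Path → LaurentPoly
F μ = map (pathWeight μ) (pathsBelow μ)

-- substitution  x ↦ p^M q^M x, y ↦ y, p ↦ q^{-1}, q ↦ p^{-1}
-- on a monomial x^a y^b p^c q^d  gives  x^a y^b p^{Ma - d} q^{Ma - c}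
substₘ : ℕ → Monomial → Monomial
substₘ M (a , b , c , d) = (a , b , (+ M) ℤ.* a ℤ.- d , (+ M) ℤ.* a ℤ.- c)

substPoly : ℕ → LaurentPoly → LaurentPoly
substPoly M P = map (substₘ M) P

module Submission where

-- A valley of a path is a factor D U.  Let μ end with D and write μ = α x β for one of its steps x.
-- The label of x only depends on β:  label + valleys (x β) = 1 + |β|.  For a right step this is the
-- recurrence s_i = s_{i+1} + k + [k = 0] computed by the algorithm, k being the number of up steps
-- before the next right step; for an up step it follows from y(j) = s_i + 1 at a peak and
-- y(j) = 1 + y(j+1) otherwise.  If μ also starts with U, then y(1) is the largest y-label, so
-- M + valleys μ = 1 + |μ|.  Duality preserves valleys and exchanges the parts before and after a
-- step, so the labels of a step of μ and of the corresponding step of the dual path add up to M.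
-- Finally ν ↦ dual ν is a bijection between the paths weakly below μ and those weakly below its
-- dual, sending a peak (i , j) to the peak (N(U) - j , N(D) - i); by the two label identities the
-- substitution turns the weight of the dual of ν into the weight of ν.

open import Defs
open import Relation.Binary.PropositionalEquality as ≡
  using (_≡_; _≢_; ≢-sym; refl; sym; trans; cong; cong₂; subst; subst₂; isEquivalence; module ≡-Reasoning)
open import Algebra.Structures using (IsCommutativeMonoid)
open import Algebra.Structures.Biased using (isCommutativeMonoidʳ)
open import Data.Bool using (true; false; if_then_else_; T)
open import Data.Bool.Properties as Bool using (T-∧)
open import Data.Empty using (⊥; ⊥-elim)
open import Data.Integer as ℤ using (ℤ)
import Data.Integer.Properties as ℤP
import Data.Integer.Tactic.RingSolver as ℤSolver
open import Data.List
  using (List; []; _∷_; _∷ʳ_; _++_; length; replicate; last; foldr; map; upTo; reverse; take; drop; filter)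
open import Data.List.Properties
  using ( ∷-injectiveʳ; ++-assoc; ++-identityʳ; length-++; length-replicate; length-drop; take++drop≡id
        ; unfold-reverse; reverse-map; map-∘; map-cong-local)
open import Data.List.Membership.Propositional using (_∈_)
open import Data.List.Membership.Propositional.Properties using (∈-map⁺; ∈-map⁻; ∈-++⁺ˡ; ∈-++⁺ʳ; ∈-++⁻)
open import Data.List.Membership.Propositional.Properties.WithK using (unique∧set⇒bag)
open import Data.List.Relation.Binary.BagAndSetEquality using (∼bag⇒↭)
open import Data.List.Relation.Binary.Disjoint.Propositional using (Disjoint)
open import Data.List.Relation.Binary.Permutation.Propositional using (_↭_; module PermutationReasoning)
import Data.List.Relation.Binary.Permutation.Propositional.Properties as ↭
open import Data.List.Relation.Binary.Permutation.Setoid.Properties (≡.setoid Monomial)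
  using (foldr-commMonoid; ↭-reverse)
open import Data.List.Relation.Unary.All as All using (All; []; _∷_)
import Data.List.Relation.Unary.All.Properties as AllP
open import Data.List.Relation.Unary.AllPairs using ([]; _∷_)
open import Data.List.Relation.Unary.Any using (here)
open import Data.List.Relation.Unary.Unique.Propositional using (Unique)
import Data.List.Relation.Unary.Unique.Propositional.Properties as Unique
open import Data.Maybe using (just; nothing)
open import Data.Nat using (ℕ; zero; suc; _+_; _∸_; _⊔_; _≤_; _<_; z≤n; s≤s; z<s; _≡ᵇ_; _≤ᵇ_)
open import Data.Nat.Properties
open import Data.Nat.Tactic.RingSolver using (solve-∀)
open import Data.Product as Product using (∃; ∃₂; _×_; _,_; proj₁; proj₂)
open import Data.Sum using (inj₁; inj₂)
open import Data.Unit using (tt)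
open import Function using (_∘_; id)
open import Function.Bundles using (mk⇔; Equivalence)
open import Relation.Nullary using (Dec; yes; no; does)
open import Relation.Nullary.Decidable using (dec-true; dec-false)
open import Relation.Unary using (Decidable)

-- Counting steps, splitting and duality

countU-++ : ∀ α β → countU (α ++ β) ≡ countU α + countU β
countU-++ []      β = refl
countU-++ (U ∷ α) β = cong suc (countU-++ α β)
countU-++ (D ∷ α) β = countU-++ α β

countD-++ : ∀ α β → countD (α ++ β) ≡ countD α + countD β
countD-++ []      β = refl
countD-++ (U ∷ α) β = countD-++ α β
countD-++ (D ∷ α) β = cong suc (countD-++ α β)

countU+countD≡length : ∀ w → countU w + countD w ≡ length w
countU+countD≡length []      = refl
countU+countD≡length (U ∷ w) = cong suc (countU+countD≡length w)
countU+countD≡length (D ∷ w) = trans (+-suc (countU w) (countD w)) (cong suc (countU+countD≡length w))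

countU-replicateU : ∀ k → countU (replicate k U) ≡ k
countU-replicateU zero    = refl
countU-replicateU (suc k) = cong suc (countU-replicateU k)

countD-replicateU : ∀ k → countD (replicate k U) ≡ 0
countD-replicateU zero    = refl
countD-replicateU (suc k) = countD-replicateU k

countD-++D∷replicateU : ∀ α k → countD (α ++ D ∷ replicate k U) ≡ suc (countD α)
countD-++D∷replicateU α k = begin
  countD (α ++ D ∷ replicate k U)       ≡⟨ countD-++ α _ ⟩
  countD α + suc (countD (replicate k U)) ≡⟨ cong (λ n → countD α + suc n) (countD-replicateU k) ⟩
  countD α + 1                          ≡⟨ +-comm (countD α) 1 ⟩
  suc (countD α)                        ∎
  where open ≡-Reasoning

countU-at-U : ∀ {μ} α β → μ ≡ α ++ U ∷ β → countU μ ≡ suc (countU α + countU β)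
countU-at-U α β refl = trans (countU-++ α (U ∷ β)) (+-suc (countU α) (countU β))

countU-∸-after : ∀ {μ} α β → μ ≡ α ++ U ∷ β → countU μ ∸ countU β ≡ suc (countU α)
countU-∸-after α β eq =
  trans (cong (_∸ countU β) (countU-at-U α β eq)) (m+n∸n≡m (suc (countU α)) (countU β))

countU-∸-before : ∀ {μ} α β → μ ≡ α ++ U ∷ β → countU μ ∸ suc (countU α) ≡ countU β
countU-∸-before α β eq =
  trans (cong (_∸ suc (countU α)) (countU-at-U α β eq)) (m+n∸m≡n (countU α) (countU β))

count : Step → Path → ℕ
count U = countU
count D = countD

split-at : ∀ x w {k} → k < count x w → ∃₂ λ α β → w ≡ α ++ x ∷ β × count x α ≡ k
split-at U (U ∷ w) {zero}  _ = [] , w , refl , refl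
split-at U (U ∷ w) {suc k} (s≤s k<n) with split-at U w k<n
... | α , β , eq , refl = U ∷ α , β , cong (U ∷_) eq , refl
split-at U (D ∷ w) k<n with split-at U w k<n
... | α , β , eq , refl = D ∷ α , β , cong (D ∷_) eq , refl
split-at D (D ∷ w) {zero}  _ = [] , w , refl , refl
split-at D (D ∷ w) {suc k} (s≤s k<n) with split-at D w k<n
... | α , β , eq , refl = D ∷ α , β , cong (D ∷_) eq , refl
split-at D (U ∷ w) k<n with split-at D w k<n
... | α , β , eq , refl = U ∷ α , β , cong (U ∷_) eq , refl

replicate-++-∷ : ∀ {A : Set} k (x : A) ys → replicate k x ++ x ∷ ys ≡ x ∷ replicate k x ++ ys
replicate-++-∷ zero    x ys = refl
replicate-++-∷ (suc k) x ys = cong (x ∷_) (replicate-++-∷ k x ys)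

last-++-∷ : ∀ {A : Set} (α : List A) x β → last (α ++ x ∷ β) ≡ last (x ∷ β)
last-++-∷ []          x β = refl
last-++-∷ (a ∷ [])    x β = refl
last-++-∷ (a ∷ b ∷ α) x β = last-++-∷ (b ∷ α) x β

last-∷-replicate : ∀ {A : Set} (x y : A) k → last (x ∷ replicate (suc k) y) ≡ just y
last-∷-replicate x y zero    = refl
last-∷-replicate x y (suc k) = last-∷-replicate x y k

dual-++ : ∀ α β → dual (α ++ β) ≡ dual β ++ dual α
dual-++ []      β = sym (++-identityʳ (dual β))
dual-++ (x ∷ α) β = trans (cong (_∷ʳ dualStep x) (dual-++ α β)) (++-assoc (dual β) (dual α) _)

dual-split : ∀ {μ} α x β → μ ≡ α ++ x ∷ β → dual μ ≡ dual β ++ dualStep x ∷ dual α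
dual-split α x β refl = trans (dual-++ α (x ∷ β)) (++-assoc (dual β) _ (dual α))

dualStep-involutive : ∀ x → dualStep (dualStep x) ≡ x
dualStep-involutive U = refl
dualStep-involutive D = refl

dual-involutive : ∀ w → dual (dual w) ≡ w
dual-involutive []      = refl
dual-involutive (x ∷ w) =
  trans (dual-++ (dual w) _) (cong₂ _∷_ (dualStep-involutive x) (dual-involutive w))

dual-injective : ∀ {v w} → dual v ≡ dual w → v ≡ w
dual-injective {v} {w} eq = trans (sym (dual-involutive v)) (trans (cong dual eq) (dual-involutive w))

countU-dual : ∀ w → countU (dual w) ≡ countD w
countU-dual []      = refl
countU-dual (U ∷ w) = trans (countU-++ (dual w) _) (trans (+-identityʳ _) (countU-dual w))
countU-dual (D ∷ w) = trans (countU-++ (dual w) _) (trans (+-comm _ 1) (cong suc (countU-dual w)))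

countD-dual : ∀ w → countD (dual w) ≡ countU w
countD-dual w = trans (sym (countU-dual (dual w))) (cong countU (dual-involutive w))

length-dual : ∀ w → length (dual w) ≡ length w
length-dual w = begin
  length (dual w)                     ≡⟨ countU+countD≡length (dual w) ⟨
  countU (dual w) + countD (dual w)   ≡⟨ cong₂ _+_ (countU-dual w) (countD-dual w) ⟩
  countD w + countU w                 ≡⟨ +-comm (countD w) (countU w) ⟩
  countU w + countD w                 ≡⟨ countU+countD≡length w ⟩
  length w                            ∎
  where open ≡-Reasoning

-- Valleys

valleys : Path → ℕ
valleys []          = 0
valleys (U ∷ w)     = valleys w
valleys (D ∷ [])    = 0
valleys (D ∷ U ∷ w) = suc (valleys (U ∷ w))
valleys (D ∷ D ∷ w) = valleys (D ∷ w)

valleys-split : ∀ α x β → valleys (α ++ x ∷ β) ≡ valleys (α ∷ʳ x) + valleys (x ∷ β)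
valleys-split []          U β = refl
valleys-split []          D β = refl
valleys-split (U ∷ α)     x β = valleys-split α x β
valleys-split (D ∷ [])    U β = refl
valleys-split (D ∷ [])    D β = refl
valleys-split (D ∷ U ∷ α) x β = cong suc (valleys-split (U ∷ α) x β)
valleys-split (D ∷ D ∷ α) x β = valleys-split (D ∷ α) x β

valleys-dual : ∀ w → valleys (dual w) ≡ valleys w
valleys-dual []          = refl
valleys-dual (U ∷ [])    = refl
valleys-dual (D ∷ [])    = refl
valleys-dual (x ∷ y ∷ w) = begin
  valleys ((dual w ∷ʳ ȳ) ∷ʳ x̄)                 ≡⟨ cong valleys (++-assoc (dual w) _ _) ⟩
  valleys (dual w ++ ȳ ∷ x̄ ∷ [])               ≡⟨ valleys-split (dual w) ȳ _ ⟩
  valleys (dual (y ∷ w)) + valleys (ȳ ∷ x̄ ∷ []) ≡⟨ cong₂ _+_ (valleys-dual (y ∷ w)) (two-steps x y) ⟩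
  valleys (y ∷ w) + valleys (x ∷ y ∷ [])       ≡⟨ +-comm (valleys (y ∷ w)) _ ⟩
  valleys (x ∷ y ∷ []) + valleys (y ∷ w)       ≡⟨ valleys-split (x ∷ []) y w ⟨
  valleys (x ∷ y ∷ w)                          ∎
  where
  open ≡-Reasoning
  x̄ = dualStep x
  ȳ = dualStep y
  two-steps : ∀ x y → valleys (dualStep y ∷ dualStep x ∷ []) ≡ valleys (x ∷ y ∷ [])
  two-steps U U = refl
  two-steps U D = refl
  two-steps D U = refl
  two-steps D D = refl

valleys-replicateU : ∀ k w → valleys (replicate k U ++ w) ≡ valleys w
valleys-replicateU zero    w = refl
valleys-replicateU (suc k) w = valleys-replicateU k w

valleys-∷ʳ-≤ : ∀ α x → valleys (α ∷ʳ x) ≤ length α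
valleys-∷ʳ-≤ []          U = z≤n
valleys-∷ʳ-≤ []          D = z≤n
valleys-∷ʳ-≤ (U ∷ α)     x = m≤n⇒m≤1+n (valleys-∷ʳ-≤ α x)
valleys-∷ʳ-≤ (D ∷ [])    U = s≤s z≤n
valleys-∷ʳ-≤ (D ∷ [])    D = z≤n
valleys-∷ʳ-≤ (D ∷ U ∷ α) x = s≤s (valleys-∷ʳ-≤ (U ∷ α) x)
valleys-∷ʳ-≤ (D ∷ D ∷ α) x = m≤n⇒m≤1+n (valleys-∷ʳ-≤ (D ∷ α) x)

-- The relabelling algorithm

tie : (ℕ → ℕ) → ℕ → ℕ
tie s i = if s i ≡ᵇ s (suc i) then 1 else 0

algStep-≤ : ∀ i s {j} → j ≤ i → algStep i s j ≡ tie s i + s j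
algStep-≤ i s {j} j≤i with s i ≡ᵇ s (suc i)
... | false = refl
... | true  rewrite dec-true (j ≤? i) j≤i = refl

algStep-> : ∀ i s {j} → i < j → algStep i s j ≡ s j
algStep-> i s {j} i<j with s i ≡ᵇ s (suc i)
... | false = refl
... | true  rewrite dec-false (j ≤? i) (<⇒≱ i<j) = refl

algDown-> : ∀ k s {j} → k < j → algDown k s j ≡ s j
algDown-> zero    s k<j = algStep-> 0 s k<j
algDown-> (suc k) s k<j = trans (algDown-> k _ (<⇒≤ k<j)) (algStep-> (suc k) s k<j)

≡ᵇ-+ˡ : ∀ d a b → (d + a ≡ᵇ d + b) ≡ (a ≡ᵇ b)
≡ᵇ-+ˡ zero    a b = refl
≡ᵇ-+ˡ (suc d) a b = ≡ᵇ-+ˡ d a b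

tie-shift : ∀ d s t j → t j ≡ d + s j → t (suc j) ≡ d + s (suc j) → tie t j ≡ tie s j
tie-shift d s t j tj t[1+j] rewrite tj | t[1+j] | ≡ᵇ-+ˡ d (s j) (s (suc j)) = refl

d+a+b≡b+a+d : ∀ d a b → d + a + b ≡ b + a + d
d+a+b≡b+a+d = solve-∀

algDown-step : ∀ k s {j} → j ≤ k → algDown k s j + s (suc j) ≡ algDown k s (suc j) + s j + tie s j
algDown-step zero s {zero} z≤n
  rewrite algStep-≤ 0 s {0} z≤n | algStep-> 0 s {1} (s≤s z≤n) = d+a+b≡b+a+d (tie s 0) (s 0) (s 1)
algDown-step (suc k) s {j} j≤1+k with m≤n⇒m<n∨m≡n j≤1+k
... | inj₁ (s≤s j≤k) = +-cancelˡ-≡ d _ _ (begin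
  d + (A + s (suc j))          ≡⟨ shuffle d A (s (suc j)) ⟩
  A + (d + s (suc j))          ≡⟨ cong (A +_) t[1+j] ⟨
  A + t (suc j)                ≡⟨ algDown-step k t j≤k ⟩
  B + t j + tie t j            ≡⟨ cong₂ (λ a b → B + a + b) tj (tie-shift d s t j tj t[1+j]) ⟩
  B + (d + s j) + tie s j      ≡⟨ shuffle′ d B (s j) (tie s j) ⟩
  d + (B + s j + tie s j)      ∎)
  where
  open ≡-Reasoning
  t = algStep (suc k) s
  d = tie s (suc k)
  A = algDown k t j
  B = algDown k t (suc j)
  tj : t j ≡ d + s j
  tj = algStep-≤ (suc k) s j≤1+k
  t[1+j] : t (suc j) ≡ d + s (suc j)
  t[1+j] = algStep-≤ (suc k) s (s≤s j≤k)
  shuffle : ∀ d a b → d + (a + b) ≡ a + (d + b)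
  shuffle = solve-∀
  shuffle′ : ∀ d a b c → a + (d + b) + c ≡ d + (a + b + c)
  shuffle′ = solve-∀
... | inj₂ refl
  rewrite algDown-> k (algStep (suc k) s) {suc k} ≤-refl
        | algDown-> k (algStep (suc k) s) {suc (suc k)} (n≤1+n (suc k))
        | algStep-≤ (suc k) s {suc k} ≤-refl
        | algStep-> (suc k) s {suc (suc k)} ≤-refl
  = d+a+b≡b+a+d (tie s (suc k)) (s (suc k)) (s (suc (suc k)))

algRun-step : ∀ n s {i} → suc i < n → algRun n s i + s (suc i) ≡ algRun n s (suc i) + s i + tie s i
algRun-step (suc (suc n)) s (s≤s (s≤s i≤n)) = algDown-step n s i≤n

algRun-last : ∀ s i → algRun (suc i) s i ≡ s i
algRun-last s zero    = refl
algRun-last s (suc i) = algDown-> i s (n<1+n i)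

-- Peaks

peaksFrom-cong : ∀ {i i′ j j′} w → i ≡ i′ → j ≡ j′ → peaksFrom i j w ≡ peaksFrom i′ j′ w
peaksFrom-cong w refl refl = refl

peaksFrom-++U : ∀ i j α r →
  peaksFrom i j (α ++ U ∷ r) ≡ peaksFrom i j α ++ peaksFrom (i + countD α) (j + countU α) (U ∷ r)
peaksFrom-++U i j []          r = peaksFrom-cong (U ∷ r) (sym (+-identityʳ i)) (sym (+-identityʳ j))
peaksFrom-++U i j (U ∷ [])    r = peaksFrom-cong (U ∷ r) (sym (+-identityʳ i)) (+-comm 1 j)
peaksFrom-++U i j (U ∷ U ∷ α) r = trans (peaksFrom-++U i (suc j) (U ∷ α) r)
  (cong (_ ++_) (peaksFrom-cong (U ∷ r) refl (sym (+-suc j _))))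
peaksFrom-++U i j (U ∷ D ∷ α) r = cong (_ ∷_) (trans (peaksFrom-++U (suc i) (suc j) α r)
  (cong (_ ++_) (peaksFrom-cong (U ∷ r) (sym (+-suc i _)) (sym (+-suc j _)))))
peaksFrom-++U i j (D ∷ α)     r = trans (peaksFrom-++U (suc i) j α r)
  (cong (_ ++_) (peaksFrom-cong (U ∷ r) (sym (+-suc i _)) refl))

peaksFrom-∷ʳD-++ : ∀ i j α r →
  peaksFrom i j ((α ∷ʳ D) ++ r) ≡ peaksFrom i j (α ∷ʳ D) ++ peaksFrom (i + suc (countD α)) (j + countU α) r
peaksFrom-∷ʳD-++ i j []          r = peaksFrom-cong r (+-comm 1 i) (sym (+-identityʳ j))
peaksFrom-∷ʳD-++ i j (U ∷ [])    r = cong (_ ∷_) (peaksFrom-cong r (+-comm 1 i) (+-comm 1 j))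
peaksFrom-∷ʳD-++ i j (U ∷ U ∷ α) r = trans (peaksFrom-∷ʳD-++ i (suc j) (U ∷ α) r)
  (cong (_ ++_) (peaksFrom-cong r refl (sym (+-suc j _))))
peaksFrom-∷ʳD-++ i j (U ∷ D ∷ α) r = cong (_ ∷_) (trans (peaksFrom-∷ʳD-++ (suc i) (suc j) α r)
  (cong (_ ++_) (peaksFrom-cong r (sym (+-suc i _)) (sym (+-suc j _)))))
peaksFrom-∷ʳD-++ i j (D ∷ α)     r = trans (peaksFrom-∷ʳD-++ (suc i) j α r)
  (cong (_ ++_) (peaksFrom-cong r (sym (+-suc i _)) refl))

peaks-∷ʳU : ∀ w → peaks (w ∷ʳ U) ≡ peaks w
peaks-∷ʳU w = trans (peaksFrom-++U 0 0 w []) (++-identityʳ (peaks w))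

peaks-∷ʳD∷ʳD : ∀ w → peaks ((w ∷ʳ D) ∷ʳ D) ≡ peaks (w ∷ʳ D)
peaks-∷ʳD∷ʳD w = trans (peaksFrom-∷ʳD-++ 0 0 w (D ∷ [])) (++-identityʳ (peaks (w ∷ʳ D)))

peaks-∷ʳU∷ʳD : ∀ w → peaks ((w ∷ʳ U) ∷ʳ D) ≡ peaks w ∷ʳ (countD w , suc (countU w))
peaks-∷ʳU∷ʳD w = trans (cong peaks (++-assoc w (U ∷ []) (D ∷ []))) (peaksFrom-++U 0 0 w (D ∷ []))

record InBox (i j : ℕ) (w : Path) (p : ℕ × ℕ) : Set where
  constructor box
  field
    left-of : proj₁ p < i + countD w
    above   : j < proj₂ p
    below   : proj₂ p ≤ j + countU w

InBox-weaken : ∀ {i j w i′ j′ w′} →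
               i′ + countD w′ ≤ i + countD w → j ≤ j′ → j′ + countU w′ ≤ j + countU w →
               ∀ {p} → InBox i′ j′ w′ p → InBox i j w p
InBox-weaken hi hj hk (box a< j<b b≤) = box (≤-trans a< hi) (≤-<-trans hj j<b) (≤-trans b≤ hk)

peaksFrom-InBox : ∀ i j w → All (InBox i j w) (peaksFrom i j w)
peaksFrom-InBox i j []          = []
peaksFrom-InBox i j (U ∷ [])    = []
peaksFrom-InBox i j (U ∷ U ∷ w) =
  All.map (InBox-weaken ≤-refl (n≤1+n j) (≤-reflexive (sym (+-suc j _)))) (peaksFrom-InBox i (suc j) (U ∷ w))
peaksFrom-InBox i j (U ∷ D ∷ w) =
  box (m<m+n i z<s) (n<1+n j) (≤-trans (s≤s (m≤m+n j _)) (≤-reflexive (sym (+-suc j _)))) ∷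
  All.map (InBox-weaken (≤-reflexive (sym (+-suc i _))) (n≤1+n j) (≤-reflexive (sym (+-suc j _))))
          (peaksFrom-InBox (suc i) (suc j) w)
peaksFrom-InBox i j (D ∷ w)     =
  All.map (InBox-weaken (≤-reflexive (sym (+-suc i _))) ≤-refl ≤-refl) (peaksFrom-InBox (suc i) j w)

peakAtHeight-++ : ∀ {h} ps qs → All (λ p → proj₂ p ≢ h) ps → peakAtHeight (ps ++ qs) h ≡ peakAtHeight qs h
peakAtHeight-++     []             qs []        = refl
peakAtHeight-++ {h} ((i , j) ∷ ps) qs (j≢h ∷ a) rewrite dec-false (j ≟ h) j≢h = peakAtHeight-++ ps qs a

peakAtHeight-none : ∀ {h} ps → All (λ p → proj₂ p ≢ h) ps → peakAtHeight ps h ≡ nothing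
peakAtHeight-none     []             []        = refl
peakAtHeight-none {h} ((i , j) ∷ ps) (j≢h ∷ a) rewrite dec-false (j ≟ h) j≢h = peakAtHeight-none ps a

peaks-below : ∀ α → All (λ p → proj₂ p ≢ suc (countU α)) (peaks α)
peaks-below α = All.map (λ b → <⇒≢ (s≤s (InBox.below b))) (peaksFrom-InBox 0 0 α)

peakAtHeight-UD : ∀ α γ → peakAtHeight (peaks (α ++ U ∷ D ∷ γ)) (suc (countU α)) ≡ just (countD α)
peakAtHeight-UD α γ rewrite peaksFrom-++U 0 0 α (D ∷ γ)
                          | peakAtHeight-++ (peaks α) (peaksFrom (countD α) (countU α) (U ∷ D ∷ γ)) (peaks-below α)
                          | dec-true (countU α ≟ countU α) refl = refl

peakAtHeight-UU : ∀ α γ → peakAtHeight (peaks (α ++ U ∷ U ∷ γ)) (suc (countU α)) ≡ nothing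
peakAtHeight-UU α γ rewrite peaksFrom-++U 0 0 α (U ∷ γ)
                          | peakAtHeight-++ (peaks α) (peaksFrom (countD α) (countU α) (U ∷ U ∷ γ)) (peaks-below α) =
  peakAtHeight-none (peaksFrom _ _ (U ∷ γ))
                    (All.map (λ b → ≢-sym (<⇒≢ (InBox.above b))) (peaksFrom-InBox _ _ (U ∷ γ)))

flipPeak : ℕ → ℕ → ℕ × ℕ → ℕ × ℕ
flipPeak A B (i , j) = (B ∸ j , A ∸ i)

peaksFrom-dual : ∀ a b {A B} w → A ≡ a + countD w → B ≡ b + countU w →
                 peaks (dual w) ≡ reverse (map (flipPeak A B) (peaksFrom a b w))
peaksFrom-dual a b []          A≡ B≡ = refl
peaksFrom-dual a b (U ∷ [])    A≡ B≡ = refl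
peaksFrom-dual a b (D ∷ w)     A≡ B≡ =
  trans (peaks-∷ʳU (dual w)) (peaksFrom-dual (suc a) b w (trans A≡ (+-suc a _)) B≡)
peaksFrom-dual a b (U ∷ U ∷ w) A≡ B≡ =
  trans (peaks-∷ʳD∷ʳD (dual w)) (peaksFrom-dual a (suc b) (U ∷ w) A≡ (trans B≡ (+-suc b _)))
peaksFrom-dual a b {A} {B} (U ∷ D ∷ w) A≡ B≡ = begin
  peaks ((dual w ∷ʳ U) ∷ʳ D)                                  ≡⟨ peaks-∷ʳU∷ʳD (dual w) ⟩
  peaks (dual w) ∷ʳ (countD (dual w) , suc (countU (dual w)))  ≡⟨ cong₂ _∷ʳ_ rest corner ⟩
  reverse (map f later) ∷ʳ f (a , suc b)                      ≡⟨ unfold-reverse _ (map f later) ⟨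
  reverse (map f (peaksFrom a b (U ∷ D ∷ w)))                 ∎
  where
  open ≡-Reasoning
  f = flipPeak A B
  later = peaksFrom (suc a) (suc b) w
  rest : peaks (dual w) ≡ reverse (map f later)
  rest = peaksFrom-dual (suc a) (suc b) w (trans A≡ (+-suc a _)) (trans B≡ (+-suc b _))
  corner : (countD (dual w) , suc (countU (dual w))) ≡ f (a , suc b)
  corner rewrite A≡ | B≡ | +-suc b (countU w) =
    cong₂ _,_ (trans (countD-dual w) (sym (m+n∸m≡n b (countU w))))
              (trans (cong suc (countU-dual w)) (sym (m+n∸m≡n a (suc (countD w)))))

peaks-dual : ∀ w → peaks (dual w) ≡ reverse (map (flipPeak (countD w) (countU w)) (peaks w))
peaks-dual w = peaksFrom-dual 0 0 w refl refl

-- Labels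

heights-at : ∀ h α β → at (dHeightsFrom h (α ++ D ∷ β)) (countD α) ≡ h + countU α
heights-at h []      β = sym (+-identityʳ h)
heights-at h (U ∷ α) β = trans (heights-at (suc h) α β) (sym (+-suc h (countU α)))
heights-at h (D ∷ α) β = heights-at h α β

s′-at : ∀ {μ} α β {i} → μ ≡ α ++ D ∷ β → countD α ≡ i → s′ μ i ≡ suc (countU β)
s′-at α β refl refl = begin
  suc (countU (α ++ D ∷ β)) ∸ height (α ++ D ∷ β) (countD α)
    ≡⟨ cong₂ (λ a b → suc a ∸ b) (countU-++ α (D ∷ β)) (heights-at 0 α β) ⟩
  suc (countU α + countU β) ∸ countU α
    ≡⟨ cong (_∸ countU α) (sym (+-suc (countU α) (countU β))) ⟩
  countU α + suc (countU β) ∸ countU α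
    ≡⟨ m+n∸m≡n (countU α) (suc (countU β)) ⟩
  suc (countU β)
    ∎
  where open ≡-Reasoning

yGo-peak : ∀ μ k {i} → peakAtHeight (peaks μ) (countU μ ∸ k) ≡ just i → yGo μ k ≡ suc (sLabel μ i)
yGo-peak μ zero    peak rewrite peak = refl
yGo-peak μ (suc k) peak rewrite peak = refl

yGo-noPeak : ∀ μ k → peakAtHeight (peaks μ) (countU μ ∸ suc k) ≡ nothing → yGo μ (suc k) ≡ suc (yGo μ k)
yGo-noPeak μ k noPeak rewrite noPeak = refl

-- The bonus 1 of a tie (k = 0) makes up for the valley that k > 0 up steps would create.
valleys-run : ∀ k c γ →
  k + (if k + c ≡ᵇ c then 1 else 0) + valleys (D ∷ replicate k U ++ D ∷ γ) ≡ suc k + valleys (D ∷ γ)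
valleys-run zero    c γ rewrite dec-true (c ≟ c) refl = refl
valleys-run (suc k) c γ rewrite dec-false (suc k + c ≟ c) (≢-sym (m≢1+n+m c)) | valleys-replicateU k (D ∷ γ) =
  trans (cong (_+ suc (valleys (D ∷ γ))) (+-identityʳ (suc k))) (+-suc (suc k) _)

-- The label of the step x of μ that follows α: s_i for a right step, y(j) for an up step.
label : Path → Path → Step → ℕ
label μ α D = sLabel μ (countD α)
label μ α U = yLabel μ (suc (countU α))

module Labels (μ : Path) (μ-ends-D : last μ ≡ just D) where

  last-U-impossible : last μ ≡ just U → ⊥
  last-U-impossible last-U with trans (sym last-U) μ-ends-D
  ... | ()

  sLabel-next : ∀ α k γ → μ ≡ α ++ D ∷ replicate k U ++ D ∷ γ →
    sLabel μ (countD α) ≡ sLabel μ (suc (countD α)) + k + (if k + countU γ ≡ᵇ countU γ then 1 else 0)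
  sLabel-next α k γ eq = +-cancelʳ-≡ (suc c) _ _ (begin
    sLabel μ i + suc c                  ≡⟨ cong (sLabel μ i +_) s′-[1+i] ⟨
    sLabel μ i + s′ μ (suc i)           ≡⟨ algRun-step (countD μ) (s′ μ) {i} 1+i<D ⟩
    S + s′ μ i + tie (s′ μ) i           ≡⟨ cong₂ (λ a b → S + a + b) s′-i tie-value ⟩
    S + suc (k + c) + t                 ≡⟨ rearrange S k c t ⟩
    S + k + t + suc c                   ∎)
    where
    open ≡-Reasoning
    i = countD α
    c = countU γ
    S = sLabel μ (suc i)
    t = if k + c ≡ᵇ c then 1 else 0
    α′ = α ++ D ∷ replicate k U
    eq′ : μ ≡ α′ ++ D ∷ γ
    eq′ = trans eq (sym (++-assoc α _ _))
    s′-i : s′ μ i ≡ suc (k + c)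
    s′-i = trans (s′-at α (replicate k U ++ D ∷ γ) eq refl)
                 (cong suc (trans (countU-++ (replicate k U) (D ∷ γ)) (cong (_+ c) (countU-replicateU k))))
    s′-[1+i] : s′ μ (suc i) ≡ suc c
    s′-[1+i] = s′-at α′ γ eq′ (countD-++D∷replicateU α k)
    tie-value : tie (s′ μ) i ≡ t
    tie-value = cong₂ (λ a b → if a ≡ᵇ b then 1 else 0) s′-i s′-[1+i]
    1+i<D : suc i < countD μ
    1+i<D = subst (suc i <_) (sym (trans (cong countD eq′) (countD-++ α′ (D ∷ γ))))
                  (subst (λ n → suc i < n + suc (countD γ)) (sym (countD-++D∷replicateU α k)) (m<m+n (suc i) z<s))
    rearrange : ∀ a k c t → a + suc (k + c) + t ≡ a + k + t + suc c
    rearrange = solve-∀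

  sLabel-run : ∀ α k β {i} → μ ≡ α ++ D ∷ replicate k U ++ β → countD α ≡ i →
               sLabel μ i + valleys (D ∷ replicate k U ++ β) ≡ suc (length (replicate k U ++ β))
  sLabel-run α zero    [] eq refl = trans (+-identityʳ _) (begin
    algRun (countD μ) (s′ μ) (countD α)        ≡⟨ cong (λ n → algRun n (s′ μ) (countD α)) D-count ⟩
    algRun (suc (countD α)) (s′ μ) (countD α)  ≡⟨ algRun-last (s′ μ) (countD α) ⟩
    s′ μ (countD α)                            ≡⟨ s′-at α [] eq refl ⟩
    1                                          ∎)
    where
    open ≡-Reasoning
    D-count : countD μ ≡ suc (countD α)
    D-count = trans (cong countD eq) (trans (countD-++ α (D ∷ [])) (+-comm (countD α) 1))
  sLabel-run α (suc k) [] eq refl =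
    ⊥-elim (last-U-impossible (begin
      last μ                                         ≡⟨ cong last eq ⟩
      last (α ++ D ∷ replicate (suc k) U ++ [])      ≡⟨ last-++-∷ α D _ ⟩
      last (D ∷ replicate (suc k) U ++ [])           ≡⟨ cong (λ r → last (D ∷ r)) (++-identityʳ (replicate (suc k) U)) ⟩
      last (D ∷ replicate (suc k) U)                 ≡⟨ last-∷-replicate D U k ⟩
      just U                                         ∎))
    where open ≡-Reasoning
  sLabel-run α k (U ∷ β) eq refl =
    subst (λ r → sLabel μ (countD α) + valleys (D ∷ r) ≡ suc (length r)) (sym (replicate-++-∷ k U β))
          (sLabel-run α (suc k) β (trans eq (cong (λ r → α ++ D ∷ r) (replicate-++-∷ k U β))) refl)
  sLabel-run α k (D ∷ γ) eq refl = begin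
    sLabel μ (countD α) + V                ≡⟨ cong (_+ V) (sLabel-next α k γ eq) ⟩
    S + k + t + V                          ≡⟨ reassoc S k t V ⟩
    S + (k + t + V)                        ≡⟨ cong (S +_) (valleys-run k (countU γ) γ) ⟩
    S + (suc k + valleys (D ∷ γ))          ≡⟨ exchange S (suc k) (valleys (D ∷ γ)) ⟩
    suc k + (S + valleys (D ∷ γ))          ≡⟨ cong (suc k +_) next ⟩
    suc k + suc (length γ)                 ≡⟨ cong suc length-run ⟨
    suc (length (replicate k U ++ D ∷ γ))  ∎
    where
    open ≡-Reasoning
    S = sLabel μ (suc (countD α))
    t = if k + countU γ ≡ᵇ countU γ then 1 else 0
    V = valleys (D ∷ replicate k U ++ D ∷ γ)
    next : S + valleys (D ∷ γ) ≡ suc (length γ)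
    next = sLabel-run (α ++ D ∷ replicate k U) 0 γ (trans eq (sym (++-assoc α _ _))) (countD-++D∷replicateU α k)
    length-run : length (replicate k U ++ D ∷ γ) ≡ k + suc (length γ)
    length-run = trans (length-++ (replicate k U)) (cong (_+ _) (length-replicate k))
    reassoc : ∀ a b c d → a + b + c + d ≡ a + (b + c + d)
    reassoc = solve-∀
    exchange : ∀ a b c → a + (b + c) ≡ b + (a + c)
    exchange = solve-∀

  yGo-run : ∀ α β → μ ≡ α ++ U ∷ β → yGo μ (countU β) + valleys (U ∷ β) ≡ suc (length β)
  yGo-run α []      eq = ⊥-elim (last-U-impossible (trans (cong last eq) (last-++-∷ α U [])))
  yGo-run α (D ∷ γ) eq = begin
    yGo μ (countU γ) + valleys (D ∷ γ)            ≡⟨ cong (_+ valleys (D ∷ γ)) (yGo-peak μ (countU γ) peak) ⟩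
    suc (sLabel μ (countD α) + valleys (D ∷ γ))   ≡⟨ cong suc (sLabel-run (α ∷ʳ U) 0 γ eq′ countD-α∷ʳU) ⟩
    suc (suc (length γ))                          ∎
    where
    open ≡-Reasoning
    eq′ : μ ≡ (α ∷ʳ U) ++ D ∷ γ
    eq′ = trans eq (sym (++-assoc α _ _))
    countD-α∷ʳU : countD (α ∷ʳ U) ≡ countD α
    countD-α∷ʳU = trans (countD-++ α _) (+-identityʳ _)
    peak : peakAtHeight (peaks μ) (countU μ ∸ countU γ) ≡ just (countD α)
    peak = trans (cong (peakAtHeight (peaks μ)) (countU-∸-after α (D ∷ γ) eq))
                 (trans (cong (λ m → peakAtHeight (peaks m) _) eq) (peakAtHeight-UD α γ))
  yGo-run α (U ∷ γ) eq = begin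
    yGo μ (suc (countU γ)) + valleys (U ∷ γ)      ≡⟨ cong (_+ valleys (U ∷ γ)) (yGo-noPeak μ (countU γ) noPeak) ⟩
    suc (yGo μ (countU γ) + valleys (U ∷ γ))      ≡⟨ cong suc (yGo-run (α ∷ʳ U) γ eq′) ⟩
    suc (suc (length γ))                          ∎
    where
    open ≡-Reasoning
    eq′ : μ ≡ (α ∷ʳ U) ++ U ∷ γ
    eq′ = trans eq (sym (++-assoc α _ _))
    noPeak : peakAtHeight (peaks μ) (countU μ ∸ suc (countU γ)) ≡ nothing
    noPeak = trans (cong (peakAtHeight (peaks μ)) (countU-∸-after α (U ∷ γ) eq))
                   (trans (cong (λ m → peakAtHeight (peaks m) _) eq) (peakAtHeight-UU α γ))

  label-valleys : ∀ α x β → μ ≡ α ++ x ∷ β → label μ α x + valleys (x ∷ β) ≡ suc (length β)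
  label-valleys α D β eq = sLabel-run α 0 β eq refl
  label-valleys α U β eq =
    subst (λ k → yGo μ k + valleys (U ∷ β) ≡ suc (length β)) (sym (countU-∸-before α β eq)) (yGo-run α β eq)

-- Monomials

monomial-≡ : ∀ {a b c d a′ b′ c′ d′ : ℤ} → a ≡ a′ → b ≡ b′ → c ≡ c′ → d ≡ d′ →
             _≡_ {A = Monomial} (a , b , c , d) (a′ , b′ , c′ , d′)
monomial-≡ refl refl refl refl = refl

·ₘ-assoc : ∀ m n o → (m ·ₘ n) ·ₘ o ≡ m ·ₘ (n ·ₘ o)
·ₘ-assoc (a , b , c , d) (a′ , b′ , c′ , d′) (a″ , b″ , c″ , d″) =
  monomial-≡ (ℤP.+-assoc a a′ a″) (ℤP.+-assoc b b′ b″) (ℤP.+-assoc c c′ c″) (ℤP.+-assoc d d′ d″)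

·ₘ-comm : ∀ m n → m ·ₘ n ≡ n ·ₘ m
·ₘ-comm (a , b , c , d) (a′ , b′ , c′ , d′) =
  monomial-≡ (ℤP.+-comm a a′) (ℤP.+-comm b b′) (ℤP.+-comm c c′) (ℤP.+-comm d d′)

·ₘ-identityʳ : ∀ m → m ·ₘ oneₘ ≡ m
·ₘ-identityʳ (a , b , c , d) =
  monomial-≡ (ℤP.+-identityʳ a) (ℤP.+-identityʳ b) (ℤP.+-identityʳ c) (ℤP.+-identityʳ d)

·ₘ-isCommutativeMonoid : IsCommutativeMonoid _≡_ _·ₘ_ oneₘ
·ₘ-isCommutativeMonoid = isCommutativeMonoidʳ (record
  { isSemigroup = record
    { isMagma = record { isEquivalence = isEquivalence ; ∙-cong = cong₂ _·ₘ_ }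
    ; assoc   = ·ₘ-assoc
    }
  ; identityʳ = ·ₘ-identityʳ
  ; comm      = ·ₘ-comm
  })

product-reverse : ∀ ms → foldr _·ₘ_ oneₘ (reverse ms) ≡ foldr _·ₘ_ oneₘ ms
product-reverse ms = foldr-commMonoid ·ₘ-isCommutativeMonoid (↭-reverse ms)

substₘ-· : ∀ M m n → substₘ M (m ·ₘ n) ≡ substₘ M m ·ₘ substₘ M n
substₘ-· M (a , b , c , d) (a′ , b′ , c′ , d′) =
  monomial-≡ refl refl (distrib (ℤ.+ M) a a′ d d′) (distrib (ℤ.+ M) a a′ c c′)
  where
  distrib : ∀ m a a′ d d′ →
            m ℤ.* (a ℤ.+ a′) ℤ.- (d ℤ.+ d′) ≡ (m ℤ.* a ℤ.- d) ℤ.+ (m ℤ.* a′ ℤ.- d′)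
  distrib = ℤSolver.solve-∀

substₘ-product : ∀ M ms → substₘ M (foldr _·ₘ_ oneₘ ms) ≡ foldr _·ₘ_ oneₘ (map (substₘ M) ms)
substₘ-product M []       = monomial-≡ refl refl M*0-0≡0 M*0-0≡0
  where
  M*0-0≡0 : ℤ.+ M ℤ.* ℤ.0ℤ ℤ.- ℤ.0ℤ ≡ ℤ.0ℤ
  M*0-0≡0 = trans (ℤP.+-identityʳ _) (ℤP.*-zeroʳ (ℤ.+ M))
substₘ-product M (m ∷ ms) = trans (substₘ-· M m _) (cong (substₘ M m ·ₘ_) (substₘ-product M ms))

ℤ-complement : ∀ {M} a b → a + b ≡ M → ℤ.+ M ℤ.* ℤ.+ 1 ℤ.- ℤ.+ b ≡ ℤ.+ a
ℤ-complement a b refl = trans (cong (λ z → z ℤ.* ℤ.1ℤ ℤ.- ℤ.+ b) (ℤP.pos-+ a b)) (cancel (ℤ.+ a) (ℤ.+ b))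
  where
  cancel : ∀ x y → (x ℤ.+ y) ℤ.* ℤ.1ℤ ℤ.- y ≡ x
  cancel = ℤSolver.solve-∀

substₘ-peak : ∀ M s y s′ y′ → s + y′ ≡ M → y + s′ ≡ M →
  substₘ M (ℤ.+ 1 , ℤ.+ y′ ℤ.- ℤ.+ s′ , ℤ.+ s′ , ℤ.+ y′) ≡
  (ℤ.+ 1 , ℤ.+ y ℤ.- ℤ.+ s , ℤ.+ s , ℤ.+ y)
substₘ-peak M s y s′ y′ s+y′≡M y+s′≡M =
  monomial-≡ refl exponent-of-y (ℤ-complement s y′ s+y′≡M) (ℤ-complement y s′ y+s′≡M)
  where
  difference : ∀ m a b → (m ℤ.- a) ℤ.- (m ℤ.- b) ≡ b ℤ.- a
  difference = ℤSolver.solve-∀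
  exponent-of-y : ℤ.+ y′ ℤ.- ℤ.+ s′ ≡ ℤ.+ y ℤ.- ℤ.+ s
  exponent-of-y = trans (sym (difference (ℤ.+ M ℤ.* ℤ.+ 1) (ℤ.+ s′) (ℤ.+ y′)))
                        (cong₂ ℤ._-_ (ℤ-complement y s′ y+s′≡M) (ℤ-complement s y′ s+y′≡M))

coeff-↭ : ∀ {P Q} → P ↭ Q → P ≈ₚ Q
coeff-↭ P↭Q m = ↭.↭-length (↭.filter-↭ (_≟ₘ m) P↭Q)

-- Paths weakly below a path

∈-allPaths⁻ : ∀ a b {w} → w ∈ allPaths a b → countU w ≡ a × countD w ≡ b
∈-allPaths⁻ zero    zero    (here refl) = refl , refl
∈-allPaths⁻ (suc a) zero    w∈ with ∈-map⁻ (U ∷_) w∈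
... | v , v∈ , refl = Product.map₁ (cong suc) (∈-allPaths⁻ a 0 v∈)
∈-allPaths⁻ zero    (suc b) w∈ with ∈-map⁻ (D ∷_) w∈
... | v , v∈ , refl = Product.map₂ (cong suc) (∈-allPaths⁻ 0 b v∈)
∈-allPaths⁻ (suc a) (suc b) w∈ with ∈-++⁻ (map (U ∷_) (allPaths a (suc b))) w∈
... | inj₁ w∈U with ∈-map⁻ (U ∷_) w∈U
...   | v , v∈ , refl = Product.map₁ (cong suc) (∈-allPaths⁻ a (suc b) v∈)
∈-allPaths⁻ (suc a) (suc b) w∈ | inj₂ w∈D with ∈-map⁻ (D ∷_) w∈D
...   | v , v∈ , refl = Product.map₂ (cong suc) (∈-allPaths⁻ (suc a) b v∈)

U∷-∈-allPaths : ∀ a b {w} → w ∈ allPaths a b → U ∷ w ∈ allPaths (suc a) b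
U∷-∈-allPaths a zero    w∈ = ∈-map⁺ (U ∷_) w∈
U∷-∈-allPaths a (suc b) w∈ = ∈-++⁺ˡ (∈-map⁺ (U ∷_) w∈)

D∷-∈-allPaths : ∀ a b {w} → w ∈ allPaths a b → D ∷ w ∈ allPaths a (suc b)
D∷-∈-allPaths zero    b w∈ = ∈-map⁺ (D ∷_) w∈
D∷-∈-allPaths (suc a) b w∈ = ∈-++⁺ʳ (map (U ∷_) (allPaths a (suc b))) (∈-map⁺ (D ∷_) w∈)

∈-allPaths⁺ : ∀ w → w ∈ allPaths (countU w) (countD w)
∈-allPaths⁺ []      = here refl
∈-allPaths⁺ (U ∷ w) = U∷-∈-allPaths (countU w) (countD w) (∈-allPaths⁺ w)
∈-allPaths⁺ (D ∷ w) = D∷-∈-allPaths (countU w) (countD w) (∈-allPaths⁺ w)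

dual-∈-allPaths : ∀ w → dual w ∈ allPaths (countD w) (countU w)
dual-∈-allPaths w = subst₂ (λ a b → dual w ∈ allPaths a b) (countU-dual w) (countD-dual w) (∈-allPaths⁺ (dual w))

allPaths-unique : ∀ a b → Unique (allPaths a b)
allPaths-unique zero    zero    = [] ∷ []
allPaths-unique (suc a) zero    = Unique.map⁺ ∷-injectiveʳ (allPaths-unique a 0)
allPaths-unique zero    (suc b) = Unique.map⁺ ∷-injectiveʳ (allPaths-unique 0 b)
allPaths-unique (suc a) (suc b) = Unique.++⁺ (Unique.map⁺ ∷-injectiveʳ (allPaths-unique a (suc b)))
                                             (Unique.map⁺ ∷-injectiveʳ (allPaths-unique (suc a) b))
                                             first-steps-differ
  where
  first-steps-differ : ∀ {xs ys} → Disjoint (map (U ∷_) xs) (map (D ∷_) ys)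
  first-steps-differ (∈U , ∈D) with ∈-map⁻ (U ∷_) ∈U | ∈-map⁻ (D ∷_) ∈D
  ... | _ , _ , refl | _ , _ , ()

map-dual-allPaths : ∀ a b → map dual (allPaths a b) ↭ allPaths b a
map-dual-allPaths a b =
  ∼bag⇒↭ (unique∧set⇒bag (Unique.map⁺ dual-injective (allPaths-unique a b)) (allPaths-unique b a) (mk⇔ to from))
  where
  to : ∀ {w} → w ∈ map dual (allPaths a b) → w ∈ allPaths b a
  to w∈ with ∈-map⁻ dual w∈
  ... | v , v∈ , refl with ∈-allPaths⁻ a b v∈
  ...   | refl , refl = dual-∈-allPaths v
  from : ∀ {w} → w ∈ allPaths b a → w ∈ map dual (allPaths a b)
  from {w} w∈ with ∈-allPaths⁻ b a w∈
  ... | refl , refl = subst (_∈ map dual (allPaths a b)) (dual-involutive w) (∈-map⁺ dual (dual-∈-allPaths w))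

map-filter-map : ∀ {A B C : Set} {P : A → Set} {Q : B → Set} (P? : Decidable P) (Q? : Decidable Q)
                 (f : A → B) (g : A → C) (h : B → C) {xs} →
                 All (λ x → does (P? x) ≡ does (Q? (f x)) × g x ≡ h (f x)) xs →
                 map g (filter P? xs) ≡ map h (filter Q? (map f xs))
map-filter-map P? Q? f g h []                             = refl
map-filter-map P? Q? f g h {x ∷ xs} ((same , g≡h) ∷ rest) with P? x | Q? (f x)
... | yes _ | yes _ = cong₂ _∷_ g≡h (map-filter-map P? Q? f g h rest)
... | no _  | no _  = map-filter-map P? Q? f g h rest
... | yes _ | no _  with () ← same
... | no _  | yes _ with () ← same

T-injective : ∀ {a b} → (T a → T b) → (T b → T a) → a ≡ b
T-injective {true}  {true}  _ _ = refl
T-injective {true}  {false} f _ = ⊥-elim (f tt)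
T-injective {false} {true}  _ g = ⊥-elim (g tt)
T-injective {false} {false} _ _ = refl

allᵇ⇒All : ∀ f xs → T (allᵇ f xs) → All (T ∘ f) xs
allᵇ⇒All f []       _ = []
allᵇ⇒All f (x ∷ xs) h = proj₁ (Equivalence.to T-∧ h) ∷ allᵇ⇒All f xs (proj₂ (Equivalence.to T-∧ h))

All⇒allᵇ : ∀ f {xs} → All (T ∘ f) xs → T (allᵇ f xs)
All⇒allᵇ f []         = tt
All⇒allᵇ f (fx ∷ fxs) = Equivalence.from T-∧ (fx , All⇒allᵇ f fxs)

Below : Path → Path → Set
Below ν μ = ∀ {t} → t ≤ length μ → countD (take t μ) ≤ countD (take t ν)

weaklyBelow⇒Below : ∀ ν μ → T (weaklyBelow ν μ) → Below ν μ
weaklyBelow⇒Below ν μ h {t} t≤n =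
  ≤ᵇ⇒≤ _ _ (AllP.applyUpTo⁻ id (suc (length μ)) (allᵇ⇒All below-at _ h) (s≤s t≤n))
  where
  below-at = λ t → countD (take t μ) ≤ᵇ countD (take t ν)

Below⇒weaklyBelow : ∀ ν μ → Below ν μ → T (weaklyBelow ν μ)
Below⇒weaklyBelow ν μ h =
  All⇒allᵇ _ (AllP.applyUpTo⁺₁ id (suc (length μ)) (λ t<1+n → ≤⇒≤ᵇ (h (≤-pred t<1+n))))

take-length-++ : ∀ {A : Set} (xs ys : List A) → take (length xs) (xs ++ ys) ≡ xs
take-length-++ []       ys = refl
take-length-++ (x ∷ xs) ys = cong (x ∷_) (take-length-++ xs ys)

take-dual : ∀ w {t} → t ≤ length w → take t (dual w) ≡ dual (drop (length w ∸ t) w)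
take-dual w {t} t≤n = begin
  take t (dual w)                              ≡⟨ cong (take t ∘ dual) (take++drop≡id k w) ⟨
  take t (dual (take k w ++ drop k w))         ≡⟨ cong (take t) (dual-++ (take k w) (drop k w)) ⟩
  take t (dual (drop k w) ++ dual (take k w))  ≡⟨ cong (λ n → take n (suffix ++ prefix)) length-suffix ⟨
  take (length suffix) (suffix ++ prefix)      ≡⟨ take-length-++ suffix prefix ⟩
  dual (drop k w)                              ∎
  where
  open ≡-Reasoning
  k = length w ∸ t
  suffix = dual (drop k w)
  prefix = dual (take k w)
  length-suffix : length (dual (drop k w)) ≡ t
  length-suffix = trans (length-dual (drop k w)) (trans (length-drop k w) (m∸[m∸n]≡n t≤n))

countU-drop : ∀ k w → k ≤ length w → countU (drop k w) + k ≡ countU w + countD (take k w)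
countU-drop zero    w       _         = trans (+-identityʳ _) (sym (+-identityʳ _))
countU-drop (suc k) (U ∷ w) (s≤s k≤n) = trans (+-suc _ k) (cong suc (countU-drop k w k≤n))
countU-drop (suc k) (D ∷ w) (s≤s k≤n) =
  trans (+-suc _ k) (trans (cong suc (countU-drop k w k≤n)) (sym (+-suc _ _)))

Below-dual : ∀ ν μ → countU ν ≡ countU μ → length ν ≡ length μ → Below ν μ → Below (dual ν) (dual μ)
Below-dual ν μ U≡ len≡ below {t} t≤n = subst₂ _≤_ (sym (D-take μ refl)) (sym (D-take ν len≡))
  (+-cancelʳ-≤ k _ _ (begin
    countU (drop k μ) + k            ≡⟨ countU-drop k μ (m∸n≤m _ t) ⟩
    countU μ + countD (take k μ)     ≤⟨ +-mono-≤ (≤-reflexive (sym U≡)) (below (m∸n≤m _ t)) ⟩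
    countU ν + countD (take k ν)     ≡⟨ countU-drop k ν (subst (k ≤_) (sym len≡) (m∸n≤m _ t)) ⟨
    countU (drop k ν) + k            ∎))
  where
  open ≤-Reasoning
  k = length μ ∸ t
  t≤ : t ≤ length μ
  t≤ = subst (t ≤_) (length-dual μ) t≤n
  D-take : ∀ w → length w ≡ length μ → countD (take t (dual w)) ≡ countU (drop k w)
  D-take w len≡μ = trans (cong countD (take-dual w (subst (t ≤_) (sym len≡μ) t≤)))
                         (trans (countD-dual (drop (length w ∸ t) w)) (cong (λ n → countU (drop (n ∸ t) w)) len≡μ))

weaklyBelow-dual : ∀ ν μ → countU ν ≡ countU μ → countD ν ≡ countD μ →
                   weaklyBelow (dual ν) (dual μ) ≡ weaklyBelow ν μ
weaklyBelow-dual ν μ U≡ D≡ = T-injective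
  (λ h → Below⇒weaklyBelow ν μ (subst₂ Below (dual-involutive ν) (dual-involutive μ)
           (Below-dual (dual ν) (dual μ) dual-U≡ dual-len≡ (weaklyBelow⇒Below (dual ν) (dual μ) h))))
  (λ h → Below⇒weaklyBelow (dual ν) (dual μ) (Below-dual ν μ U≡ len≡ (weaklyBelow⇒Below ν μ h)))
  where
  len≡ : length ν ≡ length μ
  len≡ = trans (sym (countU+countD≡length ν)) (trans (cong₂ _+_ U≡ D≡) (countU+countD≡length μ))
  dual-U≡ : countU (dual ν) ≡ countU (dual μ)
  dual-U≡ = trans (countU-dual ν) (trans D≡ (sym (countU-dual μ)))
  dual-len≡ : length (dual ν) ≡ length (dual μ)
  dual-len≡ = trans (length-dual ν) (trans len≡ (sym (length-dual μ)))

-- Duality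

foldr-⊔-lub : ∀ {c} xs → All (_≤ c) xs → foldr _⊔_ 0 xs ≤ c
foldr-⊔-lub []       []           = z≤n
foldr-⊔-lub (x ∷ xs) (x≤c ∷ xs≤c) = ⊔-lub x≤c (foldr-⊔-lub xs xs≤c)

module Duality (ρ : Path) (μ-ends-D : last (U ∷ ρ) ≡ just D) where

  μ = U ∷ ρ
  μ̄ = dual μ

  μ̄-ends-D : last μ̄ ≡ just D
  μ̄-ends-D = last-++-∷ (dual ρ) D []

  open Labels μ μ-ends-D using (label-valleys)
  open Labels μ̄ μ̄-ends-D using () renaming (label-valleys to label-valleys̄)

  yLabel-1 : yLabel μ 1 + valleys μ ≡ length μ
  yLabel-1 = label-valleys [] U ρ refl

  yLabel-≤-yLabel-1 : ∀ j → j < countU μ → yLabel μ (suc j) ≤ yLabel μ 1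
  yLabel-≤-yLabel-1 j j<n with split-at U μ j<n
  ... | α , β , eq , refl = +-cancelʳ-≤ (valleys μ) _ _ (begin
    y + valleys μ                              ≡⟨ cong (y +_) (trans (cong valleys eq) (valleys-split α U β)) ⟩
    y + (valleys (α ∷ʳ U) + valleys (U ∷ β))   ≡⟨ x+[y+z]≡x+z+y y (valleys (α ∷ʳ U)) (valleys (U ∷ β)) ⟩
    y + valleys (U ∷ β) + valleys (α ∷ʳ U)     ≡⟨ cong (_+ valleys (α ∷ʳ U)) (label-valleys α U β eq) ⟩
    suc (length β) + valleys (α ∷ʳ U)          ≤⟨ +-monoʳ-≤ (suc (length β)) (valleys-∷ʳ-≤ α U) ⟩
    suc (length β) + length α                  ≡⟨ +-comm (suc (length β)) (length α) ⟩
    length α + suc (length β)                  ≡⟨ trans (cong length eq) (length-++ α) ⟨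
    length μ                                   ≡⟨ yLabel-1 ⟨
    yLabel μ 1 + valleys μ                     ∎)
    where
    open ≤-Reasoning
    y = yLabel μ (suc (countU α))
    x+[y+z]≡x+z+y : ∀ x y z → x + (y + z) ≡ x + z + y
    x+[y+z]≡x+z+y = solve-∀

  bigM-valleys : bigM μ + valleys μ ≡ suc (length μ)
  bigM-valleys = cong suc (trans (cong (_+ valleys μ) max≡yLabel-1) yLabel-1)
    where
    max≡yLabel-1 : foldr _⊔_ 0 (map (λ k → yLabel μ (suc k)) (upTo (countU μ))) ≡ yLabel μ 1
    max≡yLabel-1 = m≥n⇒m⊔n≡m (foldr-⊔-lub _ (AllP.map⁺ (AllP.applyUpTo⁺₁ suc (countU ρ)
                     (λ i<n → yLabel-≤-yLabel-1 _ (s≤s i<n)))))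

  label-dual : ∀ α x β → μ ≡ α ++ x ∷ β → label μ α x + label μ̄ (dual β) (dualStep x) ≡ bigM μ
  label-dual α x β eq = +-cancelʳ-≡ (valleys μ) _ _ (begin
    a + b + valleys μ                              ≡⟨ cong (a + b +_) (trans (cong valleys eq) (valleys-split α x β)) ⟩
    a + b + (valleys (α ∷ʳ x) + valleys (x ∷ β))   ≡⟨ shuffle a b (valleys (α ∷ʳ x)) (valleys (x ∷ β)) ⟩
    (a + valleys (x ∷ β)) + (b + valleys (α ∷ʳ x)) ≡⟨ cong₂ _+_ (label-valleys α x β eq) b-valleys ⟩
    suc (length β) + suc (length α)                ≡⟨ +-comm (suc (length β)) (suc (length α)) ⟩
    suc (length α + suc (length β))                ≡⟨ cong suc (trans (cong length eq) (length-++ α)) ⟨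
    suc (length μ)                                 ≡⟨ bigM-valleys ⟨
    bigM μ + valleys μ                             ∎)
    where
    open ≡-Reasoning
    a = label μ α x
    b = label μ̄ (dual β) (dualStep x)
    b-valleys : b + valleys (α ∷ʳ x) ≡ suc (length α)
    b-valleys = begin
      b + valleys (α ∷ʳ x)
        ≡⟨ cong (b +_) (trans (cong valleys (sym (dual-++ α (x ∷ [])))) (valleys-dual (α ∷ʳ x))) ⟨
      b + valleys (dualStep x ∷ dual α)
        ≡⟨ label-valleys̄ (dual β) (dualStep x) (dual α) (dual-split α x β eq) ⟩
      suc (length (dual α))
        ≡⟨ cong suc (length-dual α) ⟩
      suc (length α)
        ∎
    shuffle : ∀ a b c d → a + b + (c + d) ≡ (a + d) + (b + c)
    shuffle = solve-∀

  sLabel-dual : ∀ {i} → i < countD μ → sLabel μ i + yLabel μ̄ (countD μ ∸ i) ≡ bigM μ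
  sLabel-dual i<n with split-at D μ i<n
  ... | α , β , eq , refl =
    subst (λ n → sLabel μ (countD α) + yLabel μ̄ n ≡ bigM μ) (sym index) (label-dual α D β eq)
    where
    index : countD μ ∸ countD α ≡ suc (countU (dual β))
    index = trans (cong (λ w → countD w ∸ countD α) eq)
                  (trans (cong (_∸ countD α) (countD-++ α (D ∷ β)))
                  (trans (m+n∸m≡n (countD α) _) (cong suc (sym (countU-dual β)))))

  yLabel-dual : ∀ {j} → j < countU μ → yLabel μ (suc j) + sLabel μ̄ (countU μ ∸ suc j) ≡ bigM μ
  yLabel-dual j<n with split-at U μ j<n
  ... | α , β , eq , refl =
    subst (λ n → yLabel μ (suc (countU α)) + sLabel μ̄ n ≡ bigM μ) (sym index) (label-dual α U β eq)
    where
    index : countU μ ∸ suc (countU α) ≡ countD (dual β)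
    index = trans (countU-∸-before α β eq) (sym (countD-dual β))

  peakWeight-dual : ∀ ν → countU ν ≡ countU μ → countD ν ≡ countD μ → ∀ {p} → InBox 0 0 ν p →
                    substₘ (bigM μ) (peakWeight μ̄ (flipPeak (countD ν) (countU ν) p)) ≡ peakWeight μ p
  peakWeight-dual ν U≡ D≡ {i , zero}  (box _ () _)
  peakWeight-dual ν U≡ D≡ {i , suc j} (box i<n _ j<n) =
    trans (cong₂ (λ a b → substₘ (bigM μ) (peakWeight μ̄ (flipPeak a b (i , suc j)))) D≡ U≡)
          (substₘ-peak (bigM μ) (sLabel μ i) (yLabel μ (suc j)) _ _
             (sLabel-dual (subst (i <_) D≡ i<n)) (yLabel-dual (subst (suc j ≤_) U≡ j<n)))

  pathWeight-dual : ∀ ν → countU ν ≡ countU μ → countD ν ≡ countD μ →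
                    substₘ (bigM μ) (pathWeight μ̄ (dual ν)) ≡ pathWeight μ ν
  pathWeight-dual ν U≡ D≡ = begin
    substₘ M (∏ (map (peakWeight μ̄) (peaks (dual ν))))
      ≡⟨ substₘ-product M (map (peakWeight μ̄) (peaks (dual ν))) ⟩
    ∏ (map (substₘ M) (map (peakWeight μ̄) (peaks (dual ν))))
      ≡⟨ cong ∏ (map-∘ (peaks (dual ν))) ⟨
    ∏ (map g (peaks (dual ν)))
      ≡⟨ cong (∏ ∘ map g) (peaks-dual ν) ⟩
    ∏ (map g (reverse (map τ (peaks ν))))
      ≡⟨ cong ∏ (reverse-map g (map τ (peaks ν))) ⟩
    ∏ (reverse (map g (map τ (peaks ν))))
      ≡⟨ product-reverse (map g (map τ (peaks ν))) ⟩
    ∏ (map g (map τ (peaks ν)))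
      ≡⟨ cong ∏ (map-∘ (peaks ν)) ⟨
    ∏ (map (g ∘ τ) (peaks ν))
      ≡⟨ cong ∏ (map-cong-local peakwise) ⟩
    ∏ (map (peakWeight μ) (peaks ν))
      ∎
    where
    open ≡-Reasoning
    M = bigM μ
    ∏ = foldr _·ₘ_ oneₘ
    τ = flipPeak (countD ν) (countU ν)
    g = substₘ M ∘ peakWeight μ̄
    peakwise : All (λ p → g (τ p) ≡ peakWeight μ p) (peaks ν)
    peakwise = All.map (peakWeight-dual ν U≡ D≡) (peaksFrom-InBox 0 0 ν)

  F-dual : F μ ↭ substPoly (bigM μ) (F μ̄)
  F-dual = begin
    map (pathWeight μ) (filter (below? μ) (allPaths A B))
      ≡⟨ map-filter-map (below? μ) (below? μ̄) dual (pathWeight μ) h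
                        (All.tabulate (transport ∘ ∈-allPaths⁻ A B)) ⟩
    map h (filter (below? μ̄) (map dual (allPaths A B)))
      ↭⟨ ↭.map⁺ h (↭.filter-↭ (below? μ̄) (map-dual-allPaths A B)) ⟩
    map h (filter (below? μ̄) (allPaths B A))
      ≡⟨ cong₂ (λ a b → map h (filter (below? μ̄) (allPaths a b))) (countU-dual μ) (countD-dual μ) ⟨
    map h (filter (below? μ̄) (allPaths (countU μ̄) (countD μ̄)))
      ≡⟨ map-∘ (pathsBelow μ̄) ⟩
    substPoly (bigM μ) (F μ̄)
      ∎
    where
    open PermutationReasoning
    A = countU μ
    B = countD μ
    below? : (μ′ ν : Path) → Dec (weaklyBelow ν μ′ ≡ true)
    below? μ′ ν = weaklyBelow ν μ′ Bool.≟ true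
    h : Path → Monomial
    h = substₘ (bigM μ) ∘ pathWeight μ̄
    transport : ∀ {ν} → countU ν ≡ A × countD ν ≡ B →
                does (below? μ ν) ≡ does (below? μ̄ (dual ν)) × pathWeight μ ν ≡ h (dual ν)
    transport {ν} (U≡ , D≡) = cong (λ b → does (b Bool.≟ true)) (sym (weaklyBelow-dual ν μ U≡ D≡))
                            , sym (pathWeight-dual ν U≡ D≡)

proposition4p5 : (μ : Path) → (∃ λ ρ → μ ≡ U ∷ ρ) → (∃ λ ρ → μ ≡ ρ ∷ʳ D) →
    F μ ≈ₚ substPoly (bigM μ) (F (dual μ))
proposition4p5 .(U ∷ ρ) (ρ , refl) (ρ′ , μ≡ρ′∷ʳD) = coeff-↭ F-dual
  where open Duality ρ (trans (cong last μ≡ρ′∷ʳD) (last-++-∷ ρ′ D []))
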